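{- Let $B$ be a Bratteli diagram such that the dimension group $K_0(B)$ is simple and has rank greater than $1$. Then $B$ is thick.
   Context: A Bratteli diagram $(V,E,d)$ consists of a vertex set $V=\bigsqcup_{n\geq0}V_n$ and edge set $E=\bigsqcup_{n\geq1}E_n$ (disjoint unions of nonempty finite sets), range and source maps $r,s:E\to V$ with $r[E_n]\subseteq V_n$, $s[E_n]\subseteq V_{n-1}$, $s^{ -1}(v)\neq\emptyset$ for all $v\in V$, and a labelling $d:V\to\mathbb{N}\setminus\{0\}$ with $d(v)\geq\sum_{r(e)=v}d(s(e))$ for $v\in V\setminus V_0$. The incidence matrix $M_n$ has rows indexed by $V_n$, columns by $V_{n-1}$, with entry the number of edges from $v\in V_{n-1}$ to $u\in V_n$. $K_0(B)$ is the ordered (scaled) group obtained as the direct limit of $\mathbb{Z}^{V_0}\to\mathbb{Z}^{V_1}\to\cdots$, the maps being multiplication by the incidence matrices, with positive cone the union of images of the coordinatewise-nonnegative vectors (and scale the union of images of the sets $\{z: 0\leq z_v< d(v)\}$). A dimension group is simple if its only order ideals are $\{0\}$ and the whole group (an order ideal is a subgroup $J$ with $J=(J\cap A^+)-(J\cap A^+)$ such that $0\leq a\leq b\in J$ implies $a\in J$). The rank of $K_0(B)$ is the maximal size of a $\mathbb{Z}$-linearly independent subset. $B$ is thick if for every vertex $v\in V_i$ there are $j>i$ and $w\in V_j$ with at least two distinct paths from $v$ to $w$. -}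

module Defs where

open import Data.Nat as ℕ using (ℕ; zero; suc; _≤′_; ≤′-refl; ≤′-step)
open import Data.Nat.Properties using (≤⇒≤′; m≤m+n; m≤n+m)
open import Data.Integer as ℤ using (ℤ)
open import Data.Fin using (Fin)
import Data.Fin as Fin
open import Data.Product using (Σ; ∃; ∃-syntax; _×_; _,_)
open import Data.Sum using (_⊎_)
open import Relation.Binary.PropositionalEquality using (_≡_; _≢_)
open import Function using (_∘_)

sumℕ : ∀ {k} → (Fin k → ℕ) → ℕ
sumℕ {zero}  f = 0
sumℕ {suc k} f = f Fin.zero ℕ.+ sumℕ (f ∘ Fin.suc)

sumℤ : ∀ {k} → (Fin k → ℤ) → ℤ
sumℤ {zero}  f = ℤ.0ℤ
sumℤ {suc k} f = f Fin.zero ℤ.+ sumℤ (f ∘ Fin.suc)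

-- A Bratteli diagram, with V_n = Fin (size n) and the edges E_{n+1} from
-- v ∈ V_n to u ∈ V_{n+1} given as Fin (M n u v); M n is the incidence
-- matrix M_{n+1} of the paper (rows V_{n+1}, columns V_n).
record Bratteli : Set where
  field
    size     : ℕ → ℕ
    size-pos : ∀ n → 1 ℕ.≤ size n
    M        : ∀ n → Fin (size (suc n)) → Fin (size n) → ℕ
    source-nonempty : ∀ n (v : Fin (size n)) → ∃[ u ] (1 ℕ.≤ M n u v)
    d        : ∀ n → Fin (size n) → ℕ
    d-pos    : ∀ n v → 1 ℕ.≤ d n v
    d-bound  : ∀ n (u : Fin (size (suc n))) →
               sumℕ (λ v → M n u v ℕ.* d n v) ℕ.≤ d (suc n) u

module _ (B : Bratteli) where
  open Bratteli B

  Edge : ∀ n → Fin (size n) → Fin (size (suc n)) → Set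
  Edge n v u = Fin (M n u v)

  data Path (i : ℕ) (v : Fin (size i)) : (j : ℕ) → Fin (size j) → Set where
    here : Path i v i v
    step : ∀ {j w} (u : Fin (size (suc j))) → Path i v j w → Edge j w u →
           Path i v (suc j) u

  Thick : Set
  Thick = ∀ i (v : Fin (size i)) →
    ∃[ j ] (i ℕ.< j × ∃[ w ] ∃[ p ] ∃[ q ] (_≢_ {A = Path i v j w} p q))

  Vec : ℕ → Set
  Vec n = Fin (size n) → ℤ

  push : ∀ n → Vec n → Vec (suc n)
  push n z u = sumℤ (λ v → ℤ.+ (M n u v) ℤ.* z v)

  pushTo : ∀ {n L} → n ≤′ L → Vec n → Vec L
  pushTo ≤′-refl z = z
  pushTo (≤′-step p) z = push _ (pushTo p z)

  -- K_0(B) as a direct limit: representatives and their equality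
  Elem : Set
  Elem = Σ ℕ Vec

  _≈_ : Elem → Elem → Set
  (n , z) ≈ (m , w) = ∃[ L ] ∃[ p ] ∃[ q ]
    (∀ x → pushTo {n} {L} p z x ≡ pushTo {m} {L} q w x)

  𝟘 : Elem
  𝟘 = 0 , λ _ → ℤ.0ℤ

  _⊕_ : Elem → Elem → Elem
  (n , z) ⊕ (m , w) =
    n ℕ.+ m , λ x → pushTo (≤⇒≤′ (m≤m+n n m)) z x ℤ.+ pushTo (≤⇒≤′ (m≤n+m m n)) w x

  ⊖_ : Elem → Elem
  ⊖ (n , z) = n , λ x → ℤ.- z x

  _⊝_ : Elem → Elem → Elem
  a ⊝ b = a ⊕ (⊖ b)

  _·_ : ℤ → Elem → Elem
  k · (n , z) = n , λ x → k ℤ.* z x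

  Pos : Elem → Set
  Pos (n , z) = ∃[ L ] ∃[ p ] (∀ x → ℤ.0ℤ ℤ.≤ pushTo {n} {L} p z x)

  record IsOrderIdeal (J : Elem → Set) : Set where
    field
      resp   : ∀ {a b} → a ≈ b → J a → J b
      zero∈  : J 𝟘
      plus∈  : ∀ {a b} → J a → J b → J (a ⊕ b)
      neg∈   : ∀ {a} → J a → J (⊖ a)
      directed : ∀ {a} → J a → ∃[ b ] ∃[ c ]
                   (J b × Pos b × J c × Pos c × a ≈ (b ⊝ c))
      convex : ∀ {a b} → Pos a → Pos (b ⊝ a) → J b → J a

  Simple : Set₁
  Simple = ∀ (J : Elem → Set) → IsOrderIdeal J →
    (∀ a → J a → a ≈ 𝟘) ⊎ (∀ a → J a)

  RankGt1 : Set
  RankGt1 = ∃[ a ] ∃[ b ]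
    (∀ (p q : ℤ) → ((p · a) ⊕ (q · b)) ≈ 𝟘 → p ≡ ℤ.0ℤ × q ≡ ℤ.0ℤ)

-- Let e be the unit vector of a vertex v at level i. The elements of K₀(B) that are eventually
-- bounded by a multiple of e form the order ideal generated by e, which is everything because
-- K₀(B) is simple and e ≠ 0. So two independent elements a, b are bounded, at some level L > i,
-- by a multiple of the image of e. That image cannot be supported on a single vertex, for then
-- a and b would be proportional at level L; hence v reaches two vertices t₁ ≠ t₂ of level L.
-- Simplicity applied to the unit vector of t₁ bounds the image of the unit vector of t₂ at a
-- later level by a multiple of that of t₁, so t₁ and t₂ have a common descendant x, and the
-- paths from v to x through t₁ and through t₂ are distinct.

module Submission where

open import Defs hiding (Vec; push; pushTo; Elem; _≈_; 𝟘; _⊕_; ⊖_; _⊝_; _·_; Pos; Path)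
import Defs
open import Data.Nat as ℕ using (ℕ; zero; suc; _≤′_; ≤′-refl; ≤′-step)
import Data.Nat.Properties as ℕ
open import Data.Integer as ℤ using (ℤ; +_; 0ℤ; 1ℤ; -_; _+_; _-_; _*_; _≤_)
import Data.Integer.Properties as ℤ
open import Data.Integer.Tactic.RingSolver using (solve-∀)
open import Data.Fin as Fin using (Fin)
import Data.Fin.Properties as Fin
open import Data.Product using (∃; ∃-syntax; _×_; _,_; proj₁; proj₂)
open import Data.Sum using (_⊎_; inj₁; inj₂)
open import Data.Empty using (⊥-elim)
open import Function using (_∘_)
open import Relation.Nullary using (¬_; ¬?; _×-dec_; yes; no)
open import Relation.Nullary.Decidable using (decidable-stable)
open import Relation.Binary.PropositionalEquality
import Algebra.Properties.Semiring.Sum as SemiringSum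

module ℤΣ = SemiringSum ℤ.+-*-semiring

sumℤ≡sum : ∀ {k} (f : Fin k → ℤ) → sumℤ f ≡ ℤΣ.sum f
sumℤ≡sum {zero}  f = refl
sumℤ≡sum {suc k} f = cong (_+_ (f Fin.zero)) (sumℤ≡sum (f ∘ Fin.suc))

sumℤ-cong : ∀ {k} {f g : Fin k → ℤ} → f ≗ g → sumℤ f ≡ sumℤ g
sumℤ-cong {f = f} {g} f≗g = begin
  sumℤ f     ≡⟨ sumℤ≡sum f ⟩
  ℤΣ.sum f   ≡⟨ ℤΣ.sum-cong-≗ f≗g ⟩
  ℤΣ.sum g   ≡⟨ sumℤ≡sum g ⟨
  sumℤ g     ∎
  where open ≡-Reasoning

sumℤ-+ : ∀ {k} (f g : Fin k → ℤ) → sumℤ (λ x → f x + g x) ≡ sumℤ f + sumℤ g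
sumℤ-+ f g = begin
  sumℤ (λ x → f x + g x)     ≡⟨ sumℤ≡sum (λ x → f x + g x) ⟩
  ℤΣ.sum (λ x → f x + g x)   ≡⟨ ℤΣ.∑-distrib-+ f g ⟩
  ℤΣ.sum f + ℤΣ.sum g        ≡⟨ cong₂ _+_ (sumℤ≡sum f) (sumℤ≡sum g) ⟨
  sumℤ f + sumℤ g            ∎
  where open ≡-Reasoning

sumℤ-* : ∀ {k} (c : ℤ) (f : Fin k → ℤ) → sumℤ (λ x → c * f x) ≡ c * sumℤ f
sumℤ-* c f = begin
  sumℤ (λ x → c * f x)     ≡⟨ sumℤ≡sum (λ x → c * f x) ⟩
  ℤΣ.sum (λ x → c * f x)   ≡⟨ ℤΣ.*-distribˡ-sum c f ⟨
  c * ℤΣ.sum f             ≡⟨ cong (c *_) (sumℤ≡sum f) ⟨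
  c * sumℤ f               ∎
  where open ≡-Reasoning

sumℤ-mono-≤ : ∀ {k} {f g : Fin k → ℤ} → (∀ x → f x ≤ g x) → sumℤ f ≤ sumℤ g
sumℤ-mono-≤ {zero}  f≤g = ℤ.≤-refl
sumℤ-mono-≤ {suc k} f≤g = ℤ.+-mono-≤ (f≤g Fin.zero) (sumℤ-mono-≤ (f≤g ∘ Fin.suc))

sumℤ-nonneg : ∀ {k} {f : Fin k → ℤ} → (∀ x → 0ℤ ≤ f x) → 0ℤ ≤ sumℤ f
sumℤ-nonneg {zero}  f≥0 = ℤ.≤-refl
sumℤ-nonneg {suc k} f≥0 = ℤ.+-mono-≤ (f≥0 Fin.zero) (sumℤ-nonneg (f≥0 ∘ Fin.suc))

lookup≤sumℤ : ∀ {k} {f : Fin k → ℤ} → (∀ x → 0ℤ ≤ f x) → ∀ y → f y ≤ sumℤ f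
lookup≤sumℤ {suc k} {f} f≥0 Fin.zero =
  ℤ.i≤i+j _ _ {{ℤ.nonNegative (sumℤ-nonneg (f≥0 ∘ Fin.suc))}}
lookup≤sumℤ {suc k} {f} f≥0 (Fin.suc y) =
  ℤ.i≤j⇒i≤k+j _ {{ℤ.nonNegative (f≥0 Fin.zero)}} (lookup≤sumℤ (f≥0 ∘ Fin.suc) y)

sumℤ≢0⇒∃≢0 : ∀ {k} (f : Fin k → ℤ) → sumℤ f ≢ 0ℤ → ∃[ x ] f x ≢ 0ℤ
sumℤ≢0⇒∃≢0 {zero}  f sum≢0 = ⊥-elim (sum≢0 refl)
sumℤ≢0⇒∃≢0 {suc k} f sum≢0 with f Fin.zero ℤ.≟ 0ℤ
... | no  f₀≢0 = Fin.zero , f₀≢0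
... | yes f₀≡0 =
  let x , fx≢0 = sumℤ≢0⇒∃≢0 (f ∘ Fin.suc) (λ rest≡0 → sum≢0 (cong₂ _+_ f₀≡0 rest≡0))
  in Fin.suc x , fx≢0

1≤i⇒i≢0 : ∀ {i} → 1ℤ ≤ i → i ≢ 0ℤ
1≤i⇒i≢0 (ℤ.+≤+ ()) refl

+m*s≢0⇒Fin : ∀ m {s} → + m * s ≢ 0ℤ → Fin m
+m*s≢0⇒Fin zero    0≢0 = ⊥-elim (0≢0 refl)
+m*s≢0⇒Fin (suc m) _   = Fin.zero

other-nonzero⊎concentrated : ∀ {k} (f : Fin k → ℤ) (t : Fin k) →
  (∃[ t′ ] (t′ ≢ t × f t′ ≢ 0ℤ)) ⊎ (∀ y → y ≢ t → f y ≡ 0ℤ)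
other-nonzero⊎concentrated f t with Fin.any? (λ y → ¬? (y Fin.≟ t) ×-dec ¬? (f y ℤ.≟ 0ℤ))
... | yes other = inj₁ other
... | no  none  = inj₂ λ y y≢t → decidable-stable (f y ℤ.≟ 0ℤ) (λ fy≢0 → none (y , y≢t , fy≢0))

record Bounded (N : ℕ) (e a : ℤ) : Set where
  constructor bounded
  field
    lower : - (+ N * e) ≤ a
    upper : a ≤ + N * e

0≤+N*e : ∀ N {e} → 0ℤ ≤ e → 0ℤ ≤ + N * e
0≤+N*e N {e} e≥0 = ℤ.*-monoʳ-≤-nonNeg e {{ℤ.nonNegative e≥0}} {0ℤ} {+ N} (ℤ.+≤+ ℕ.z≤n)

bounded-zero : ∀ e → Bounded 0 e 0ℤ
bounded-zero e = bounded ℤ.≤-refl ℤ.≤-refl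

bounded-self : ∀ N {e} → 0ℤ ≤ e → Bounded N e (+ N * e)
bounded-self N e≥0 = bounded (ℤ.≤-trans (ℤ.neg-mono-≤ (0≤+N*e N e≥0)) (0≤+N*e N e≥0)) ℤ.≤-refl

bounded-neg : ∀ {N e a} → Bounded N e a → Bounded N e (- a)
bounded-neg {N} {e} (bounded lower upper) =
  bounded (ℤ.neg-mono-≤ upper) (subst (_ ≤_) (ℤ.neg-involutive (+ N * e)) (ℤ.neg-mono-≤ lower))

bounded-+ : ∀ {M N e a b} → Bounded M e a → Bounded N e b → Bounded (M ℕ.+ N) e (a + b)
bounded-+ {M} {N} {e} (bounded a-lower a-upper) (bounded b-lower b-upper) = bounded
  (subst (_≤ _) (sym (trans (cong -_ bound-+) (ℤ.neg-distrib-+ (+ M * e) (+ N * e))))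
         (ℤ.+-mono-≤ a-lower b-lower))
  (subst (_ ≤_) (sym bound-+) (ℤ.+-mono-≤ a-upper b-upper))
  where
  bound-+ : + (M ℕ.+ N) * e ≡ + M * e + + N * e
  bound-+ = trans (cong (_* e) (ℤ.pos-+ M N)) (ℤ.*-distribʳ-+ e (+ M) (+ N))

0≤bound-bounded : ∀ {N e a} → Bounded N e a → 0ℤ ≤ + N * e - a
0≤bound-bounded a-bounded = ℤ.i≤j⇒0≤j-i (Bounded.upper a-bounded)

bounded-convex : ∀ {N e a b} → 0ℤ ≤ a → a ≤ b → Bounded N e b → Bounded N e a
bounded-convex a≥0 a≤b (bounded _ upper) =
  bounded (ℤ.≤-trans (ℤ.neg-mono-≤ (ℤ.≤-trans a≥0 a≤upper)) a≥0) a≤upper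
  where a≤upper = ℤ.≤-trans a≤b upper

bounded-by-0 : ∀ {N a} → Bounded N 0ℤ a → a ≡ 0ℤ
bounded-by-0 {N} (bounded lower upper) = ℤ.≤-antisym
  (subst (_ ≤_) (ℤ.*-zeroʳ (+ N)) upper)
  (subst (_≤ _) (cong -_ (ℤ.*-zeroʳ (+ N))) lower)

bounded-≢0 : ∀ {N e a} → Bounded N e a → a ≢ 0ℤ → e ≢ 0ℤ
bounded-≢0 a-bounded a≢0 refl = a≢0 (bounded-by-0 a-bounded)

Eventually : (ℕ → Set) → Set
Eventually P = ∃[ L₀ ] ∀ L → L₀ ℕ.≤ L → P L

eventually-× : ∀ {P Q : ℕ → Set} → Eventually P → Eventually Q → Eventually (λ L → P L × Q L)
eventually-× (L₁ , p) (L₂ , q) =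
  L₁ ℕ.+ L₂ , λ L L≥ → p L (ℕ.≤-trans (ℕ.m≤m+n L₁ L₂) L≥) , q L (ℕ.≤-trans (ℕ.m≤n+m L₂ L₁) L≥)

eventually-map : ∀ {P Q : ℕ → Set} → (∀ {L} → P L → Q L) → Eventually P → Eventually Q
eventually-map f (L₀ , p) = L₀ , λ L L≥ → f (p L L≥)

eventually-≥′ : ∀ n → Eventually (n ≤′_)
eventually-≥′ n = n , λ _ → ℕ.≤⇒≤′

eventually⇒∃ : ∀ {P : ℕ → Set} → Eventually P → ∃ P
eventually⇒∃ (L₀ , p) = L₀ , p L₀ ℕ.≤-refl

module Diagram (B : Bratteli) where
  open Bratteli B

  infix  4 _≈_
  infixl 6 _⊕_ _⊝_
  infixr 7 _·_
  infix  8 ⊖_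

  Vec : ℕ → Set
  Vec = Defs.Vec B

  push : ∀ n → Vec n → Vec (suc n)
  push = Defs.push B

  pushTo : ∀ {n L} → n ≤′ L → Vec n → Vec L
  pushTo = Defs.pushTo B

  Elem : Set
  Elem = Defs.Elem B

  _≈_ : Elem → Elem → Set
  _≈_ = Defs._≈_ B

  𝟘 : Elem
  𝟘 = Defs.𝟘 B

  _⊕_ _⊝_ : Elem → Elem → Elem
  _⊕_ = Defs._⊕_ B
  _⊝_ = Defs._⊝_ B

  ⊖_ : Elem → Elem
  ⊖_ = Defs.⊖_ B

  _·_ : ℤ → Elem → Elem
  _·_ = Defs._·_ B

  Pos : Elem → Set
  Pos = Defs.Pos B

  Path : ∀ i → Fin (size i) → ∀ j → Fin (size j) → Set
  Path = Defs.Path B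

  NonNeg : ∀ {n} → Vec n → Set
  NonNeg z = ∀ x → 0ℤ ≤ z x

  push-cong : ∀ {n} {z w : Vec n} → z ≗ w → push n z ≗ push n w
  push-cong {n} z≗w u = sumℤ-cong (λ v → cong (+ M n u v *_) (z≗w v))

  pushTo-cong : ∀ {n L} (p : n ≤′ L) {z w : Vec n} → z ≗ w → pushTo p z ≗ pushTo p w
  pushTo-cong ≤′-refl     z≗w = z≗w
  pushTo-cong (≤′-step p) z≗w = push-cong (pushTo-cong p z≗w)

  push-+ : ∀ {n} (z w : Vec n) → push n (λ x → z x + w x) ≗ λ u → push n z u + push n w u
  push-+ {n} z w u = trans
    (sumℤ-cong (λ v → ℤ.*-distribˡ-+ (+ M n u v) (z v) (w v)))
    (sumℤ-+ (λ v → + M n u v * z v) (λ v → + M n u v * w v))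

  pushTo-+ : ∀ {n L} (p : n ≤′ L) (z w : Vec n) →
             pushTo p (λ x → z x + w x) ≗ λ u → pushTo p z u + pushTo p w u
  pushTo-+ ≤′-refl     z w u = refl
  pushTo-+ (≤′-step p) z w u = trans (push-cong (pushTo-+ p z w) u) (push-+ _ _ u)

  push-* : ∀ {n} (c : ℤ) (z : Vec n) → push n (λ x → c * z x) ≗ λ u → c * push n z u
  push-* {n} c z u = trans
    (sumℤ-cong (λ v → swap-factors (+ M n u v) c (z v)))
    (sumℤ-* c (λ v → + M n u v * z v))
    where
    swap-factors : ∀ a b d → a * (b * d) ≡ b * (a * d)
    swap-factors = solve-∀

  pushTo-* : ∀ {n L} (p : n ≤′ L) (c : ℤ) (z : Vec n) →
             pushTo p (λ x → c * z x) ≗ λ u → c * pushTo p z u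
  pushTo-* ≤′-refl     c z u = refl
  pushTo-* (≤′-step p) c z u = trans (push-cong (pushTo-* p c z) u) (push-* c _ u)

  pushTo-neg : ∀ {n L} (p : n ≤′ L) (z : Vec n) → pushTo p (λ x → - z x) ≗ λ u → - pushTo p z u
  pushTo-neg p z u = begin
    pushTo p (λ x → - z x) u         ≡⟨ pushTo-cong p (λ x → sym (ℤ.-1*i≡-i (z x))) u ⟩
    pushTo p (λ x → ℤ.-1ℤ * z x) u   ≡⟨ pushTo-* p ℤ.-1ℤ z u ⟩
    ℤ.-1ℤ * pushTo p z u             ≡⟨ ℤ.-1*i≡-i _ ⟩
    - pushTo p z u                   ∎
    where open ≡-Reasoning

  pushTo-0 : ∀ {n L} (p : n ≤′ L) → pushTo p (λ _ → 0ℤ) ≗ λ _ → 0ℤ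
  pushTo-0 p = pushTo-* p 0ℤ (λ _ → 0ℤ)

  push-mono-≤ : ∀ {n} {z w : Vec n} → (∀ x → z x ≤ w x) → ∀ u → push n z u ≤ push n w u
  push-mono-≤ {n} z≤w u = sumℤ-mono-≤ (λ v → ℤ.*-monoˡ-≤-nonNeg (+ M n u v) (z≤w v))

  pushTo-mono-≤ : ∀ {n L} (p : n ≤′ L) {z w : Vec n} →
                  (∀ x → z x ≤ w x) → ∀ u → pushTo p z u ≤ pushTo p w u
  pushTo-mono-≤ ≤′-refl     z≤w = z≤w
  pushTo-mono-≤ (≤′-step p) z≤w = push-mono-≤ (pushTo-mono-≤ p z≤w)

  pushTo-nonneg : ∀ {n L} (p : n ≤′ L) {z : Vec n} → NonNeg z → NonNeg (pushTo p z)
  pushTo-nonneg p {z} z≥0 u = subst (_≤ pushTo p z u) (pushTo-0 p u) (pushTo-mono-≤ p z≥0 u)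

  pushTo-irrelevant : ∀ {n L} (p q : n ≤′ L) (z : Vec n) → pushTo p z ≗ pushTo q z
  pushTo-irrelevant ≤′-refl     ≤′-refl     z = λ _ → refl
  pushTo-irrelevant ≤′-refl     (≤′-step q) z = ⊥-elim (ℕ.<-irrefl refl (ℕ.≤′⇒≤ q))
  pushTo-irrelevant (≤′-step p) ≤′-refl     z = ⊥-elim (ℕ.<-irrefl refl (ℕ.≤′⇒≤ p))
  pushTo-irrelevant (≤′-step p) (≤′-step q) z = push-cong (pushTo-irrelevant p q z)

  pushTo-∘ : ∀ {n m L} (p : n ≤′ m) (q : m ≤′ L) (r : n ≤′ L) (z : Vec n) →
             pushTo r z ≗ pushTo q (pushTo p z)
  pushTo-∘ p ≤′-refl     r z = pushTo-irrelevant r p z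
  pushTo-∘ p (≤′-step q) (≤′-step r) z = push-cong (pushTo-∘ p q r z)
  pushTo-∘ p (≤′-step q) ≤′-refl     z = ⊥-elim (ℕ.<-irrefl refl (ℕ.≤-trans (ℕ.≤′⇒≤ p) (ℕ.≤′⇒≤ q)))

  level : Elem → ℕ
  level = proj₁

  at : (a : Elem) → ∀ {L} → level a ≤′ L → Vec L
  at (n , z) p = pushTo p z

  at-irrelevant : ∀ a {L} (p q : level a ≤′ L) → at a p ≗ at a q
  at-irrelevant (n , z) p q = pushTo-irrelevant p q z

  at-pushTo : ∀ a {L₁ L} (p : level a ≤′ L₁) (r : L₁ ≤′ L) (q : level a ≤′ L) →
              at a q ≗ pushTo r (at a p)
  at-pushTo (n , z) p r q = pushTo-∘ p r q z

  m+n≤′o⇒m≤′o : ∀ {m n o} → m ℕ.+ n ≤′ o → m ≤′ o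
  m+n≤′o⇒m≤′o {m} q = ℕ.≤⇒≤′ (ℕ.m+n≤o⇒m≤o m (ℕ.≤′⇒≤ q))

  m+n≤′o⇒n≤′o : ∀ {m n o} → m ℕ.+ n ≤′ o → n ≤′ o
  m+n≤′o⇒n≤′o {m} q = ℕ.≤⇒≤′ (ℕ.m+n≤o⇒n≤o m (ℕ.≤′⇒≤ q))

  at-⊕ : ∀ a b {L} (q : level (a ⊕ b) ≤′ L) →
         at (a ⊕ b) q ≗ λ x → at a (m+n≤′o⇒m≤′o q) x + at b (m+n≤′o⇒n≤′o q) x
  at-⊕ (n , z) (m , w) q x = trans
    (pushTo-+ q (pushTo n≤n+m z) (pushTo m≤n+m w) x)
    (sym (cong₂ _+_ (pushTo-∘ n≤n+m q (m+n≤′o⇒m≤′o q) z x)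
                     (pushTo-∘ m≤n+m q (m+n≤′o⇒n≤′o q) w x)))
    where
    n≤n+m = ℕ.≤⇒≤′ (ℕ.m≤m+n n m)
    m≤n+m = ℕ.≤⇒≤′ (ℕ.m≤n+m m n)

  at-⊖ : ∀ a {L} (q : level a ≤′ L) → at (⊖ a) q ≗ λ x → - at a q x
  at-⊖ (n , z) q = pushTo-neg q z

  at-⊝ : ∀ a b {L} (q : level (a ⊝ b) ≤′ L) →
         at (a ⊝ b) q ≗ λ x → at a (m+n≤′o⇒m≤′o q) x - at b (m+n≤′o⇒n≤′o q) x
  at-⊝ a b q x = trans (at-⊕ a (⊖ b) q x)
    (cong (_+_ (at a (m+n≤′o⇒m≤′o q) x)) (at-⊖ b (m+n≤′o⇒n≤′o q) x))

  at-· : ∀ k a {L} (q : level a ≤′ L) → at (k · a) q ≗ λ x → k * at a q x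
  at-· k (n , z) q = pushTo-* q k z

  at-𝟘 : ∀ {L} (q : 0 ≤′ L) → at 𝟘 q ≗ λ _ → 0ℤ
  at-𝟘 = pushTo-0

  -- pushTo depends on its proof of ≤′ only up to ≗ (pushTo-irrelevant), so the level-wise
  -- predicates below quantify over all such proofs.
  PosAt : Elem → ℕ → Set
  PosAt a L = ∀ (q : level a ≤′ L) → NonNeg (at a q)

  EqAt : Elem → Elem → ℕ → Set
  EqAt a b L = ∀ (qa : level a ≤′ L) (qb : level b ≤′ L) → at a qa ≗ at b qb

  pos⇒eventually : ∀ a → Pos a → Eventually (PosAt a)
  pos⇒eventually a (L₁ , p , a≥0) = L₁ , λ L L₁≤L q x →
    subst (0ℤ ≤_) (sym (at-pushTo a p (ℕ.≤⇒≤′ L₁≤L) q x)) (pushTo-nonneg (ℕ.≤⇒≤′ L₁≤L) a≥0 x)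

  eventually⇒pos : ∀ a → Eventually (PosAt a) → Pos a
  eventually⇒pos a ev =
    let L , q , a≥0 = eventually⇒∃ (eventually-× (eventually-≥′ (level a)) ev)
    in L , q , a≥0 q

  ≈⇒eventually : ∀ a b → a ≈ b → Eventually (EqAt a b)
  ≈⇒eventually a b (L₁ , p , q , a≗b) = L₁ , λ L L₁≤L → eq-at (ℕ.≤⇒≤′ L₁≤L)
    where
    open ≡-Reasoning
    eq-at : ∀ {L} → L₁ ≤′ L → EqAt a b L
    eq-at r qa qb x = begin
      at a qa x                       ≡⟨ at-pushTo a p r qa x ⟩
      pushTo r (pushTo p (proj₂ a)) x ≡⟨ pushTo-cong r a≗b x ⟩
      pushTo r (pushTo q (proj₂ b)) x ≡⟨ at-pushTo b q r qb x ⟨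
      at b qb x                       ∎

  eventually⇒≈ : ∀ a b → Eventually (EqAt a b) → a ≈ b
  eventually⇒≈ a b ev =
    let L , q , a≗b = eventually⇒∃ (eventually-× (eventually-≥′ (level a ℕ.+ level b)) ev)
    in L , m+n≤′o⇒m≤′o q , m+n≤′o⇒n≤′o q , a≗b (m+n≤′o⇒m≤′o q) (m+n≤′o⇒n≤′o q)

  DominatedAt : Elem → ℕ → Elem → ℕ → Set
  DominatedAt e N a L =
    ∀ (qe : level e ≤′ L) (qa : level a ≤′ L) x → Bounded N (at e qe x) (at a qa x)

  Dominated : Elem → Elem → Set
  Dominated e a = ∃[ N ] Eventually (DominatedAt e N a)

  module _ (e : Elem) where

    dominated-resp : ∀ {a b} → a ≈ b → Dominated e a → Dominated e b
    dominated-resp {a} {b} a≈b (N , a-dom) = N , eventually-map b-dom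
      (eventually-× (≈⇒eventually a b a≈b) (eventually-× a-dom (eventually-≥′ (level a))))
      where
      b-dom : ∀ {L} → EqAt a b L × DominatedAt e N a L × level a ≤′ L → DominatedAt e N b L
      b-dom (a≗b , a-dom , qa) qe qb x = subst (Bounded N _) (a≗b qa qb x) (a-dom qe qa x)

    dominated-𝟘 : Dominated e 𝟘
    dominated-𝟘 = 0 , 0 , λ _ _ qe q x → subst (Bounded 0 _) (sym (at-𝟘 q x)) (bounded-zero _)

    dominated-⊕ : ∀ {a b} → Dominated e a → Dominated e b → Dominated e (a ⊕ b)
    dominated-⊕ {a} {b} (M , a-dom) (N , b-dom) =
      M ℕ.+ N , eventually-map a⊕b-dom (eventually-× a-dom b-dom)
      where
      a⊕b-dom : ∀ {L} → DominatedAt e M a L × DominatedAt e N b L →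
                DominatedAt e (M ℕ.+ N) (a ⊕ b) L
      a⊕b-dom (a-dom , b-dom) qe q x = subst (Bounded (M ℕ.+ N) _) (sym (at-⊕ a b q x))
        (bounded-+ (a-dom qe (m+n≤′o⇒m≤′o q) x) (b-dom qe (m+n≤′o⇒n≤′o q) x))

    dominated-⊖ : ∀ {a} → Dominated e a → Dominated e (⊖ a)
    dominated-⊖ {a} (N , a-dom) = N , eventually-map ⊖a-dom a-dom
      where
      ⊖a-dom : ∀ {L} → DominatedAt e N a L → DominatedAt e N (⊖ a) L
      ⊖a-dom a-dom qe q x = subst (Bounded N _) (sym (at-⊖ a q x)) (bounded-neg (a-dom qe q x))

    dominated-convex : ∀ {a b} → Pos a → Pos (b ⊝ a) → Dominated e b → Dominated e a
    dominated-convex {a} {b} a≥0 b⊝a≥0 (N , b-dom) = N , eventually-map a-dom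
      (eventually-× (pos⇒eventually a a≥0)
        (eventually-× (pos⇒eventually (b ⊝ a) b⊝a≥0)
          (eventually-× b-dom (eventually-≥′ (level b ℕ.+ level a)))))
      where
      a-dom : ∀ {L} → PosAt a L × PosAt (b ⊝ a) L × DominatedAt e N b L × level b ℕ.+ level a ≤′ L →
              DominatedAt e N a L
      a-dom (a≥0 , b⊝a≥0 , b-dom , q) qe qa x =
        bounded-convex (a≥0 qa x) (ℤ.0≤i-j⇒j≤i b-a≥0) (b-dom qe (m+n≤′o⇒m≤′o q) x)
        where
        b-a≥0 : 0ℤ ≤ at b (m+n≤′o⇒m≤′o q) x - at a qa x
        b-a≥0 = subst (0ℤ ≤_)
          (trans (at-⊝ b a q x)
            (cong (_-_ (at b (m+n≤′o⇒m≤′o q) x)) (at-irrelevant a (m+n≤′o⇒n≤′o q) qa x)))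
          (b⊝a≥0 q x)

    dominated-directed : Pos e → ∀ {a} → Dominated e a → ∃[ b ] ∃[ c ]
      (Dominated e b × Pos b × Dominated e c × Pos c × a ≈ b ⊝ c)
    dominated-directed e≥0 {a} (N , a-dom) =
      b , c , (N , b-dom) , b≥0 , (N ℕ.+ N , c-dom) , c≥0 , a≈b⊝c
      where
      b c : Elem
      b = + N · e
      c = b ⊝ a

      e-ev≥0 : Eventually (PosAt e)
      e-ev≥0 = pos⇒eventually e e≥0

      at-b : ∀ {L} (qb qe : level e ≤′ L) → at b qb ≗ λ x → + N * at e qe x
      at-b qb qe x = trans (at-· (+ N) e qb x) (cong (+ N *_) (at-irrelevant e qb qe x))

      at-c : ∀ {L} (qc : level c ≤′ L) (qe : level e ≤′ L) (qa : level a ≤′ L) →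
             at c qc ≗ λ x → + N * at e qe x - at a qa x
      at-c qc qe qa x = trans (at-⊝ b a qc x)
        (cong₂ _-_ (at-b (m+n≤′o⇒m≤′o qc) qe x) (at-irrelevant a (m+n≤′o⇒n≤′o qc) qa x))

      b-dom : Eventually (DominatedAt e N b)
      b-dom = eventually-map
        (λ e≥0 qe qb x → subst (Bounded N _) (sym (at-b qb qe x)) (bounded-self N (e≥0 qe x)))
        e-ev≥0

      b≥0 : Pos b
      b≥0 = eventually⇒pos b (eventually-map
        (λ e≥0 q x → subst (0ℤ ≤_) (sym (at-b q q x)) (0≤+N*e N (e≥0 q x)))
        e-ev≥0)

      c-dom : Eventually (DominatedAt e (N ℕ.+ N) c)
      c-dom = eventually-map
        (λ (e≥0 , a-dom) qe qc x → subst (Bounded (N ℕ.+ N) _) (sym (at-c qc qe (m+n≤′o⇒n≤′o qc) x))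
          (bounded-+ (bounded-self N (e≥0 qe x)) (bounded-neg (a-dom qe (m+n≤′o⇒n≤′o qc) x))))
        (eventually-× e-ev≥0 a-dom)

      c≥0 : Pos c
      c≥0 = eventually⇒pos c (eventually-map
        (λ a-dom qc x → subst (0ℤ ≤_) (sym (at-c qc (m+n≤′o⇒m≤′o qc) (m+n≤′o⇒n≤′o qc) x))
          (0≤bound-bounded (a-dom (m+n≤′o⇒m≤′o qc) (m+n≤′o⇒n≤′o qc) x)))
        a-dom)

      a≈b⊝c : a ≈ b ⊝ c
      a≈b⊝c = eventually⇒≈ a (b ⊝ c) (0 , λ _ _ qa q x → sym (at-b⊝c qa q x))
        where
        at-b⊝c : ∀ {L} (qa : level a ≤′ L) (q : level (b ⊝ c) ≤′ L) → at (b ⊝ c) q ≗ at a qa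
        at-b⊝c qa q x = begin
          at (b ⊝ c) q x
            ≡⟨ at-⊝ b c q x ⟩
          at b qb x - at c qc x
            ≡⟨ cong₂ _-_ (at-b qb qb x) (at-c qc qb qa x) ⟩
          + N * at e qb x - (+ N * at e qb x - at a qa x)
            ≡⟨ u-[u-v]≡v (+ N * at e qb x) (at a qa x) ⟩
          at a qa x
            ∎
          where
          open ≡-Reasoning
          qb = m+n≤′o⇒m≤′o q
          qc = m+n≤′o⇒n≤′o {level b} q
          u-[u-v]≡v : ∀ u v → u - (u - v) ≡ v
          u-[u-v]≡v = solve-∀

  dominated-isOrderIdeal : ∀ e → Pos e → IsOrderIdeal B (Dominated e)
  dominated-isOrderIdeal e e≥0 = record
    { resp     = dominated-resp e
    ; zero∈    = dominated-𝟘 e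
    ; plus∈    = dominated-⊕ e
    ; neg∈     = dominated-⊖ e
    ; directed = dominated-directed e e≥0
    ; convex   = dominated-convex e
    }

  dominated-self : ∀ e → Pos e → Dominated e e
  dominated-self e e≥0 = 1 , eventually-map
    (λ e≥0 qe qe′ x → subst (Bounded 1 _)
      (trans (ℤ.*-identityˡ (at e qe x)) (at-irrelevant e qe qe′ x)) (bounded-self 1 (e≥0 qe x)))
    (pos⇒eventually e e≥0)

  simple⇒dominated : Simple B → ∀ e → Pos e → ¬ e ≈ 𝟘 → ∀ a → Dominated e a
  simple⇒dominated simple e e≥0 e≉𝟘 with simple (Dominated e) (dominated-isOrderIdeal e e≥0)
  ... | inj₁ trivial = ⊥-elim (e≉𝟘 (trivial e (dominated-self e e≥0)))
  ... | inj₂ everything = everything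

  δ : ∀ {k} → Fin (size k) → Vec k
  δ u x with x Fin.≟ u
  ... | yes _ = 1ℤ
  ... | no  _ = 0ℤ

  δ-nonneg : ∀ {k} (u : Fin (size k)) → NonNeg (δ u)
  δ-nonneg u x with x Fin.≟ u
  ... | yes _ = ℤ.+≤+ ℕ.z≤n
  ... | no  _ = ℤ.+≤+ ℕ.z≤n

  δ-diagonal : ∀ {k} (u : Fin (size k)) → δ u u ≡ 1ℤ
  δ-diagonal u with u Fin.≟ u
  ... | yes _   = refl
  ... | no  u≢u = ⊥-elim (u≢u refl)

  δ≢0⇒≡ : ∀ {k} (u y : Fin (size k)) → δ u y ≢ 0ℤ → y ≡ u
  δ≢0⇒≡ u y δuy≢0 with y Fin.≟ u
  ... | yes y≡u = y≡u
  ... | no  _   = ⊥-elim (δuy≢0 refl)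

  unit : ∀ k → Fin (size k) → Elem
  unit k u = k , δ u

  unit-pos : ∀ k u → Pos (unit k u)
  unit-pos k u = k , ≤′-refl , δ-nonneg u

  push-positive : ∀ {n} {z : Vec n} → NonNeg z → ∀ y → 1ℤ ≤ z y → ∃[ u ] 1ℤ ≤ push n z u
  push-positive {n} {z} z≥0 y 1≤zy =
    let u , 1≤Muy = source-nonempty n y
        1≤Muy*zy = ℤ.≤-trans 1≤zy (subst (_≤ + M n u y * z y) (ℤ.*-identityˡ (z y))
                     (ℤ.*-monoʳ-≤-nonNeg (z y) {{ℤ.nonNegative (z≥0 y)}} (ℤ.+≤+ 1≤Muy)))
    in u , ℤ.≤-trans 1≤Muy*zy (lookup≤sumℤ (λ v → 0≤+N*e (M n u v) (z≥0 v)) y)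

  pushTo-positive : ∀ {n L} (p : n ≤′ L) {z : Vec n} → NonNeg z →
                    ∀ y → 1ℤ ≤ z y → ∃[ u ] 1ℤ ≤ pushTo p z u
  pushTo-positive ≤′-refl     z≥0 y 1≤zy = y , 1≤zy
  pushTo-positive (≤′-step p) z≥0 y 1≤zy =
    let u , 1≤pzu = pushTo-positive p z≥0 y 1≤zy
    in push-positive (pushTo-nonneg p z≥0) u 1≤pzu

  pushTo-δ-positive : ∀ {k L} (p : k ≤′ L) (u : Fin (size k)) → ∃[ x ] 1ℤ ≤ pushTo p (δ u) x
  pushTo-δ-positive p u = pushTo-positive p (δ-nonneg u) u (ℤ.≤-reflexive (sym (δ-diagonal u)))

  unit≉𝟘 : ∀ k u → ¬ unit k u ≈ 𝟘
  unit≉𝟘 k u (L , p , q , u≗𝟘) =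
    let x , 1≤ux = pushTo-δ-positive p u
    in 1≤i⇒i≢0 1≤ux (trans (u≗𝟘 x) (at-𝟘 q x))

  infixr 5 _++ᵖ_

  _++ᵖ_ : ∀ {i v m t L x} → Path i v m t → Path m t L x → Path i v L x
  r ++ᵖ here       = r
  r ++ᵖ step u q e = step u (r ++ᵖ q) e

  path-≤ : ∀ {m t L x} → Path m t L x → m ℕ.≤ L
  path-≤ here         = ℕ.≤-refl
  path-≤ (step u q e) = ℕ.m≤n⇒m≤1+n (path-≤ q)

  penultimate : ∀ {i v j u} → i ℕ.≤ j → Path i v (suc j) u → Fin (size j)
  penultimate _   (step {w = w} _ _ _) = w
  penultimate i≤j here                 = ⊥-elim (ℕ.<-irrefl refl i≤j)

  step-injective : ∀ {i v j w u} {p q : Path i v j w} {e₁ e₂} →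
                   _≡_ {A = Path i v (suc j) u} (step u p e₁) (step u q e₂) → p ≡ q
  step-injective refl = refl

  ++ᵖ-junction-injective : ∀ {i v m t₁ t₂ L x} (r₁ : Path i v m t₁) (r₂ : Path i v m t₂)
                           (q₁ : Path m t₁ L x) (q₂ : Path m t₂ L x) →
                           r₁ ++ᵖ q₁ ≡ r₂ ++ᵖ q₂ → t₁ ≡ t₂
  ++ᵖ-junction-injective r₁ r₂ here         here         _ = refl
  ++ᵖ-junction-injective r₁ r₂ here         (step _ q₂ _) _ = ⊥-elim (ℕ.<-irrefl refl (path-≤ q₂))
  ++ᵖ-junction-injective r₁ r₂ (step _ q₁ _) here         _ = ⊥-elim (ℕ.<-irrefl refl (path-≤ q₁))
  ++ᵖ-junction-injective r₁ r₂ (step u q₁ _) (step .u q₂ _) eq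
    with cong (penultimate (path-≤ (r₁ ++ᵖ q₁))) eq
  ... | refl = ++ᵖ-junction-injective r₁ r₂ q₁ q₂ (step-injective eq)

  pushTo≢0⇒path : ∀ {n L} (p : n ≤′ L) (z : Vec n) x →
                  pushTo p z x ≢ 0ℤ → ∃[ y ] (z y ≢ 0ℤ × Path n y L x)
  pushTo≢0⇒path ≤′-refl         z x zx≢0 = x , zx≢0 , here
  pushTo≢0⇒path (≤′-step {L} p) z x px≢0 =
    let u , Mxu*pu≢0 = sumℤ≢0⇒∃≢0 (λ v → + M L x v * pushTo p z v) px≢0
        pu≢0 = λ pu≡0 → Mxu*pu≢0 (trans (cong (+ M L x u *_) pu≡0) (ℤ.*-zeroʳ (+ M L x u)))
        y , zy≢0 , path = pushTo≢0⇒path p z u pu≢0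
    in y , zy≢0 , step x path (+m*s≢0⇒Fin (M L x u) Mxu*pu≢0)

  pushTo-δ≢0⇒path : ∀ {k L} (p : k ≤′ L) (u : Fin (size k)) x →
                    pushTo p (δ u) x ≢ 0ℤ → Path k u L x
  pushTo-δ≢0⇒path p u x px≢0 =
    let y , δuy≢0 , path = pushTo≢0⇒path p (δ u) x px≢0
    in subst (λ y → Path _ y _ x) (δ≢0⇒≡ u y δuy≢0) path

  common-descendant : Simple B → ∀ L (t₁ t₂ : Fin (size L)) →
                      ∃[ L′ ] ∃[ x ] (Path L t₁ L′ x × Path L t₂ L′ x)
  common-descendant simple L t₁ t₂ =
    let N , t₂-dom = simple⇒dominated simple (unit L t₁) (unit-pos L t₁) (unit≉𝟘 L t₁) (unit L t₂)
        L′ , dom , q = eventually⇒∃ (eventually-× t₂-dom (eventually-≥′ L))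
        x , 1≤δt₂ = pushTo-δ-positive q t₂
        δt₂≢0 = 1≤i⇒i≢0 1≤δt₂
        δt₁≢0 = bounded-≢0 (dom q q x) δt₂≢0
    in L′ , x , pushTo-δ≢0⇒path q t₁ x δt₁≢0 , pushTo-δ≢0⇒path q t₂ x δt₂≢0

  TwoPaths : ∀ i → Fin (size i) → ℕ → Set
  TwoPaths i v j = ∃[ w ] ∃[ p ] ∃[ q ] (_≢_ {A = Path i v j w} p q)

  two-paths-through : Simple B → ∀ {i v L t₁ t₂} → Path i v L t₁ → Path i v L t₂ → t₁ ≢ t₂ →
                      ∃[ j ] (L ℕ.≤ j × TwoPaths i v j)
  two-paths-through simple {L = L} {t₁} {t₂} r₁ r₂ t₁≢t₂ =
    let L′ , x , s₁ , s₂ = common-descendant simple L t₁ t₂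
    in L′ , path-≤ s₁ , x , r₁ ++ᵖ s₁ , r₂ ++ᵖ s₂ , t₁≢t₂ ∘ ++ᵖ-junction-injective r₁ r₂ s₁ s₂

  Independent : Elem → Elem → Set
  Independent a b = ∀ (p q : ℤ) → p · a ⊕ q · b ≈ 𝟘 → p ≡ 0ℤ × q ≡ 0ℤ

  -- With α, β the values of a, b at t, β·a ⊕ (- α)·b vanishes at level L, so α = 0 by
  -- independence, and then 1·a ⊕ 0·b vanishes as well.
  concentrated⇒¬independent :
    ∀ a b {L} (q : level a ℕ.+ level b ≤′ L) (t : Fin (size L)) →
    (∀ y → y ≢ t → at a (m+n≤′o⇒m≤′o q) y ≡ 0ℤ × at b (m+n≤′o⇒n≤′o q) y ≡ 0ℤ) →
    ¬ Independent a b
  concentrated⇒¬independent a b {L} q t vanish independent =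
    1≢0 (proj₁ (independent 1ℤ 0ℤ (combination≈𝟘 1ℤ 0ℤ 1α+0β≡0)))
    where
    qa = m+n≤′o⇒m≤′o q
    qb = m+n≤′o⇒n≤′o q
    α = at a qa t
    β = at b qb t

    combination≈𝟘 : ∀ r s → r * α + s * β ≡ 0ℤ → r · a ⊕ s · b ≈ 𝟘
    combination≈𝟘 r s vanishes-at-t = L , q , ℕ.≤⇒≤′ ℕ.z≤n , λ x → begin
      at (r · a ⊕ s · b) q x             ≡⟨ at-⊕ (r · a) (s · b) q x ⟩
      at (r · a) qa x + at (s · b) qb x  ≡⟨ cong₂ _+_ (at-· r a qa x) (at-· s b qb x) ⟩
      r * at a qa x + s * at b qb x      ≡⟨ vanishes x ⟩
      0ℤ                                 ≡⟨ at-𝟘 (ℕ.≤⇒≤′ ℕ.z≤n) x ⟨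
      at 𝟘 (ℕ.≤⇒≤′ ℕ.z≤n) x              ∎
      where
      open ≡-Reasoning
      vanishes : ∀ x → r * at a qa x + s * at b qb x ≡ 0ℤ
      vanishes x with x Fin.≟ t
      ... | yes refl = vanishes-at-t
      ... | no  x≢t  = let ax≡0 , bx≡0 = vanish x x≢t in
        trans (cong₂ (λ u w → r * u + s * w) ax≡0 bx≡0) (cong₂ _+_ (ℤ.*-zeroʳ r) (ℤ.*-zeroʳ s))

    βα-αβ≡0 : ∀ α β → β * α + - α * β ≡ 0ℤ
    βα-αβ≡0 = solve-∀

    α≡0 : α ≡ 0ℤ
    α≡0 = ℤ.neg-injective (proj₂ (independent β (- α) (combination≈𝟘 β (- α) (βα-αβ≡0 α β))))

    1α+0β≡0 : 1ℤ * α + 0ℤ * β ≡ 0ℤ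
    1α+0β≡0 = trans (ℤ.+-identityʳ (1ℤ * α)) (trans (ℤ.*-identityˡ α) α≡0)

    1≢0 : 1ℤ ≢ 0ℤ
    1≢0 ()

  dominates-independent⇒spread :
    ∀ {e a b N₁ N₂ L} → Independent a b →
    DominatedAt e N₁ a L → DominatedAt e N₂ b L → level a ℕ.+ level b ≤′ L →
    (qe : level e ≤′ L) (t : Fin (size L)) → ∃[ t′ ] (t′ ≢ t × at e qe t′ ≢ 0ℤ)
  dominates-independent⇒spread {e} {a} {b} {L = L} independent a-dom b-dom q qe t
    with other-nonzero⊎concentrated (at e qe) t
  ... | inj₁ spread       = spread
  ... | inj₂ concentrated = ⊥-elim (concentrated⇒¬independent a b q t
    (λ y y≢t → vanishes a-dom (m+n≤′o⇒m≤′o q) y y≢t , vanishes b-dom (m+n≤′o⇒n≤′o q) y y≢t)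
    independent)
    where
    vanishes : ∀ {N c} → DominatedAt e N c L → ∀ qc y → y ≢ t → at c qc y ≡ 0ℤ
    vanishes {N} {c} c-dom qc y y≢t = bounded-by-0
      (subst (λ s → Bounded N s (at c qc y)) (concentrated y y≢t) (c-dom qe qc y))

mainTheorem2 : (B : Bratteli) → Simple B → RankGt1 B → Thick B
mainTheorem2 B simple (a , b , independent) i v =
  let open Diagram B
      dominated = simple⇒dominated simple (unit i v) (unit-pos i v) (unit≉𝟘 i v)
      Na , a-dom = dominated a
      Nb , b-dom = dominated b
      L , a-dom , b-dom , q , i<L = eventually⇒∃ (eventually-× a-dom (eventually-× b-dom
        (eventually-× (eventually-≥′ (level a ℕ.+ level b)) (eventually-≥′ (suc i)))))
      qi = ℕ.≤⇒≤′ (ℕ.<⇒≤ (ℕ.≤′⇒≤ i<L))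
      t , 1≤δt = pushTo-δ-positive qi v
      t′ , t′≢t , δt′≢0 = dominates-independent⇒spread independent a-dom b-dom q qi t
      j , L≤j , paths = two-paths-through simple
        (pushTo-δ≢0⇒path qi v t′ δt′≢0) (pushTo-δ≢0⇒path qi v t (1≤i⇒i≢0 1≤δt)) t′≢t
  in j , ℕ.<-≤-trans (ℕ.≤′⇒≤ i<L) L≤j , paths
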